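{- Let $m$ be a positive integer. For any Ferrers board $B=(b_1,\dots,b_n)$, $$ \sum_{k=0}^n f_{k,m}(B)\, x\downarrow_{n-k,m} = \prod_{j=1}^n (x+b_j-(j-1)m). $$
   Context: A Ferrers board $B=(b_1,\dots,b_n)$ ($0\le b_1\le\dots\le b_n$ integers) is the set of the $b_j$ lowest cells of column $j$ in the first-quadrant grid of unit cells. A file placement on $B$ is a subset $F\subseteq B$ with no two cells (rooks) in the same column (several rooks may share a row). For $x$ and $n\ge0$, $x\downarrow_{n,m}=x(x-m)\cdots(x-(n-1)m)$, with $x\downarrow_{0,m}=1$. For a file placement $F$, let $t$ be the largest row index of $B$ and $y_i$ the number of rooks of $F$ in row $i$; the $m$-weight is $\mathrm{wt}_m F=\prod_{i=1}^t 1\downarrow_{y_i,m}$. Then $f_{k,m}(B)=\sum_F \mathrm{wt}_m F$, summed over file placements $F\subseteq B$ with $k$ rooks. -}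

module Defs where

open import Data.Nat as ℕ using (ℕ; zero; suc)
open import Data.Integer using (ℤ; +_; _+_; _-_; _*_)
open import Data.List using (List; []; _∷_; length; map; concatMap; filter; foldr; applyUpTo)
open import Data.Maybe using (Maybe; nothing; just)
open import Relation.Nullary.Decidable using (⌊_⌋)
open import Data.Bool using (Bool; true; false; if_then_else_)

-- A Ferrers board (b_1,...,b_n) is a list of column heights; it is a Ferrers
-- board when weakly increasing (see Statement: Linked ℕ._≤_).

sum : List ℤ → ℤ
sum = foldr _+_ (+ 0)

product : List ℤ → ℤ
product = foldr _*_ (+ 1)

-- Generalized falling factorial  x↓_{n,m} = x (x-m) ... (x-(n-1)m),  x↓_{0,m} = 1.
fall : ℤ → ℕ → ℤ → ℤ
fall x zero    m = + 1
fall x (suc n) m = x * fall (x - m) n m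

-- A file placement is given column by column: nothing = no rook in that column,
-- just r = a rook in row r (1 ≤ r ≤ b_j).
Placement : Set
Placement = List (Maybe ℕ)

placements : List ℕ → List Placement
placements []      = [] ∷ []
placements (b ∷ bs) =
  concatMap (λ p → map (λ c → c ∷ p) (nothing ∷ applyUpTo (λ i → just (suc i)) b))
            (placements bs)

rooks : Placement → ℕ
rooks []             = 0
rooks (nothing ∷ p)  = rooks p
rooks (just _ ∷ p)   = suc (rooks p)

rowCount : ℕ → Placement → ℕ
rowCount i []            = 0
rowCount i (nothing ∷ p) = rowCount i p
rowCount i (just r ∷ p)  = if ⌊ r ℕ.≟ i ⌋ then suc (rowCount i p) else rowCount i p

maxRow : List ℕ → ℕ
maxRow = foldr ℕ._⊔_ 0

wt : ℤ → List ℕ → Placement → ℤ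
wt m B F = product (applyUpTo (λ i → fall (+ 1) (rowCount (suc i) F) m) (maxRow B))

f : ℕ → ℤ → List ℕ → ℤ
f k m B = sum (map (wt m B) (filter (λ F → rooks F ℕ.≟ k) (placements B)))

lhs : ℤ → ℤ → List ℕ → ℤ
lhs m x B = sum (applyUpTo (λ k → f k m B * fall x (length B ℕ.∸ k) m) (suc (length B)))

-- right-hand side ∏_{j=1}^n (x + b_j - (j-1) m), computed with j-1 = index
rhsFrom : ℕ → ℤ → ℤ → List ℕ → ℤ
rhsFrom j m x []       = + 1
rhsFrom j m x (b ∷ bs) = (x + + b - + j * m) * rhsFrom (suc j) m x bs

rhs : ℤ → ℤ → List ℕ → ℤ
rhs m x B = rhsFrom 0 m x B

-- Build a placement column by column, left to right.  If the first n columns carry r rooks, the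
-- next column, of height b, is either left empty, which turns x↓_{n-r,m} into x↓_{n+1-r,m}, i.e.
-- multiplies by x - (n - r)m, or gets a rook in some row i ≤ b, which multiplies the weight by
-- 1 - y_i m, where y_i counts the earlier rooks in row i.  Since the board is Ferrers, all r earlier
-- rooks lie in rows ≤ b, so the y_i over i ≤ b add up to r and the b + 1 choices together multiply
-- the running sum by (x - (n - r)m) + b - rm = x + b - nm, the n-th factor of the product.

module Submission where

open import Defs
open import Data.Nat using (ℕ; _≤_)
open import Data.Integer using (ℤ; +_)
open import Data.List using (List)
open import Data.List.Relation.Unary.Linked using (Linked)
open import Relation.Binary.PropositionalEquality using (_≡_)

open import Algebra.Bundles using (CommutativeMonoid)
open import Data.Bool using (true; false; if_then_else_)
open import Data.Nat as ℕ using (zero; suc; _<_; _∸_; z≤n; s≤s; _≟_)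
import Data.Nat.Properties as ℕ
open import Data.Integer as ℤ using (_+_; _-_; _*_)
import Data.Integer.Properties as ℤ
open import Data.Integer.Tactic.RingSolver using (solve-∀)
open import Algebra.Properties.CommutativeSemigroup ℤ.*-commutativeSemigroup using (xy∙z≈xz∙y; xy∙z≈y∙xz)
open import Data.List using ([]; _∷_; _++_; _ʳ++_; reverse; map; concatMap; filter; foldr; applyUpTo; length)
import Data.List.Properties as List
open import Data.List.Relation.Unary.All as All using (All; []; _∷_)
import Data.List.Relation.Unary.All.Properties as All
open import Data.List.Relation.Unary.AllPairs using (AllPairs; _∷_)
open import Data.List.Relation.Unary.Linked.Properties using (Linked⇒AllPairs)
open import Data.Maybe using (Maybe; nothing; just)
import Data.Maybe.Relation.Unary.All as Maybe
open import Data.Product using (_×_; _,_)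
open import Function using (_∘_)
import Relation.Binary.PropositionalEquality as ≡
open import Relation.Nullary.Decidable using (does; yes; no; isYes≗does)

module BigOperator {a ℓ} (M : CommutativeMonoid a ℓ) where

  open CommutativeMonoid M
  open import Algebra.Properties.CommutativeSemigroup commutativeSemigroup using (interchange)
  open import Relation.Binary.Reasoning.Setoid setoid

  ⨁ : List Carrier → Carrier
  ⨁ = foldr _∙_ ε

  ⨁-++ : ∀ xs ys → ⨁ (xs ++ ys) ≈ ⨁ xs ∙ ⨁ ys
  ⨁-++ []       ys = sym (identityˡ _)
  ⨁-++ (x ∷ xs) ys = trans (∙-congˡ (⨁-++ xs ys)) (sym (assoc x _ _))

  ⨁-map-cong : ∀ {A : Set} {f g : A → Carrier} {xs} → All (λ x → f x ≈ g x) xs → ⨁ (map f xs) ≈ ⨁ (map g xs)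
  ⨁-map-cong []            = refl
  ⨁-map-cong (fx≈gx ∷ eqs) = ∙-cong fx≈gx (⨁-map-cong eqs)

  ⨁-map-ε : ∀ {A : Set} (xs : List A) → ⨁ (map (λ _ → ε) xs) ≈ ε
  ⨁-map-ε []       = refl
  ⨁-map-ε (_ ∷ xs) = trans (identityˡ _) (⨁-map-ε xs)

  ⨁-map-distrib : ∀ {A : Set} (f g : A → Carrier) xs → ⨁ (map (λ x → f x ∙ g x) xs) ≈ ⨁ (map f xs) ∙ ⨁ (map g xs)
  ⨁-map-distrib f g []       = sym (identityˡ ε)
  ⨁-map-distrib f g (x ∷ xs) = trans (∙-congˡ (⨁-map-distrib f g xs)) (interchange _ _ _ _)

  ⨁-map-comm : ∀ {A B : Set} (f : A → B → Carrier) xs ys →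
    ⨁ (map (λ x → ⨁ (map (f x) ys)) xs) ≈ ⨁ (map (λ y → ⨁ (map (λ x → f x y) xs)) ys)
  ⨁-map-comm f []       ys = sym (⨁-map-ε ys)
  ⨁-map-comm f (x ∷ xs) ys = begin
    ⨁ (map (f x) ys) ∙ ⨁ (map (λ x′ → ⨁ (map (f x′) ys)) xs)       ≈⟨ ∙-congˡ (⨁-map-comm f xs ys) ⟩
    ⨁ (map (f x) ys) ∙ ⨁ (map (λ y → ⨁ (map (λ x′ → f x′ y) xs)) ys) ≈⟨ ⨁-map-distrib (f x) _ ys ⟨
    ⨁ (map (λ y → f x y ∙ ⨁ (map (λ x′ → f x′ y) xs)) ys)             ∎

  ⨁-concatMap-map : ∀ {A B C : Set} (g : C → Carrier) (k : A → B → C) xs ys →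
    ⨁ (map g (concatMap (λ y → map (λ x → k x y) xs) ys)) ≈ ⨁ (map (λ y → ⨁ (map (λ x → g (k x y)) xs)) ys)
  ⨁-concatMap-map g k xs []       = refl
  ⨁-concatMap-map g k xs (y ∷ ys) = begin
    ⨁ (map g (map (λ x → k x y) xs ++ concatMap _ ys))              ≡⟨ ≡.cong ⨁ (List.map-++ g (map (λ x → k x y) xs) _) ⟩
    ⨁ (map g (map (λ x → k x y) xs) ++ map g (concatMap _ ys))      ≈⟨ ⨁-++ (map g (map (λ x → k x y) xs)) _ ⟩
    ⨁ (map g (map (λ x → k x y) xs)) ∙ ⨁ (map g (concatMap _ ys))   ≡⟨ ≡.cong (λ s → ⨁ s ∙ _) (List.map-∘ xs) ⟨
    ⨁ (map (λ x → g (k x y)) xs) ∙ ⨁ (map g (concatMap _ ys))        ≈⟨ ∙-congˡ (⨁-concatMap-map g k xs ys) ⟩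
    ⨁ (map (λ x → g (k x y)) xs) ∙ ⨁ (map (λ y′ → ⨁ (map (λ x → g (k x y′)) xs)) ys) ∎

  ⨁-applyUpTo-cong : ∀ {f g : ℕ → Carrier} n → (∀ {i} → i < n → f i ≈ g i) →
    ⨁ (applyUpTo f n) ≈ ⨁ (applyUpTo g n)
  ⨁-applyUpTo-cong zero    eq = refl
  ⨁-applyUpTo-cong (suc n) eq = ∙-cong (eq (s≤s z≤n)) (⨁-applyUpTo-cong n (eq ∘ s≤s))

  ⨁-applyUpTo-ε : ∀ n → ⨁ (applyUpTo (λ _ → ε) n) ≈ ε
  ⨁-applyUpTo-ε zero    = refl
  ⨁-applyUpTo-ε (suc n) = trans (identityˡ _) (⨁-applyUpTo-ε n)

  ⨁-applyUpTo-distrib : ∀ (f g : ℕ → Carrier) n →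
    ⨁ (applyUpTo (λ i → f i ∙ g i) n) ≈ ⨁ (applyUpTo f n) ∙ ⨁ (applyUpTo g n)
  ⨁-applyUpTo-distrib f g zero    = sym (identityˡ ε)
  ⨁-applyUpTo-distrib f g (suc n) = trans (∙-congˡ (⨁-applyUpTo-distrib (f ∘ suc) (g ∘ suc) n)) (interchange _ _ _ _)

  ⨁-applyUpTo-δ : ∀ (f : ℕ → Carrier) {j n} → j < n →
    ⨁ (applyUpTo (λ i → if does (j ≟ i) then f i else ε) n) ≈ f j
  ⨁-applyUpTo-δ f {zero}  {suc n} _         = trans (∙-congˡ (⨁-applyUpTo-ε n)) (identityʳ (f 0))
  ⨁-applyUpTo-δ f {suc j} {suc n} (s≤s j<n) = trans (identityˡ _) (⨁-applyUpTo-δ (f ∘ suc) j<n)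

module Σ = BigOperator ℤ.+-0-commutativeMonoid
module Π = BigOperator ℤ.*-1-commutativeMonoid

open ≡ using (refl; sym; trans; cong; cong₂; module ≡-Reasoning)

sum-map-*ʳ : ∀ {A : Set} (f : A → ℤ) c xs → sum (map (λ a → f a * c) xs) ≡ sum (map f xs) * c
sum-map-*ʳ f c []       = refl
sum-map-*ʳ f c (a ∷ xs) = trans (cong (λ s → f a * c + s) (sum-map-*ʳ f c xs)) (sym (ℤ.*-distribʳ-+ c (f a) _))

sum-applyUpTo-affine : ∀ c m (a : ℕ → ℤ) n →
  sum (applyUpTo (λ i → c * (+ 1 - a i * m)) n) ≡ c * (+ n - sum (applyUpTo a n) * m)
sum-applyUpTo-affine c m a zero    = empty c m
  where
  empty : ∀ c m → + 0 ≡ c * (+ 0 - + 0 * m)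
  empty = solve-∀
sum-applyUpTo-affine c m a (suc n) =
  trans (cong (λ s → c * (+ 1 - a 0 * m) + s) (sum-applyUpTo-affine c m (a ∘ suc) n)) (step c m (a 0) _ (+ n))
  where
  step : ∀ c m a₀ s n → c * (+ 1 - a₀ * m) + c * (n - s * m) ≡ c * (+ 1 + n - (a₀ + s) * m)
  step = solve-∀

sum-applyUpTo-fibres : ∀ {A : Set} (φ : A → ℕ) (g : A → ℤ) (h : ℕ → ℤ) {N} xs → All (λ a → φ a < N) xs →
  sum (applyUpTo (λ k → sum (map g (filter (λ a → φ a ≟ k) xs)) * h k) N) ≡ sum (map (λ a → g a * h (φ a)) xs)
sum-applyUpTo-fibres φ g h {N} []       []             = Σ.⨁-applyUpTo-ε N
sum-applyUpTo-fibres {A} φ g h {N} (a ∷ xs) (φa<N ∷ φxs<N) = begin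
  sum (applyUpTo (λ k → fibre (a ∷ xs) k * h k) N)
    ≡⟨ Σ.⨁-applyUpTo-cong N (λ {k} _ → fibre-∷ k) ⟩
  sum (applyUpTo (λ k → (if does (φ a ≟ k) then g a * h k else + 0) + fibre xs k * h k) N)
    ≡⟨ Σ.⨁-applyUpTo-distrib _ _ N ⟩
  sum (applyUpTo (λ k → if does (φ a ≟ k) then g a * h k else + 0) N) + sum (applyUpTo (λ k → fibre xs k * h k) N)
    ≡⟨ cong₂ _+_ (Σ.⨁-applyUpTo-δ (λ k → g a * h k) φa<N) (sum-applyUpTo-fibres φ g h xs φxs<N) ⟩
  g a * h (φ a) + sum (map (λ a → g a * h (φ a)) xs) ∎
  where
  open ≡-Reasoning
  fibre : List A → ℕ → ℤ
  fibre ys k = sum (map g (filter (λ a → φ a ≟ k) ys))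
  fibre-∷ : ∀ k → fibre (a ∷ xs) k * h k ≡ (if does (φ a ≟ k) then g a * h k else + 0) + fibre xs k * h k
  fibre-∷ k with does (φ a ≟ k)
  ... | true  = ℤ.*-distribʳ-+ (h k) (g a) (fibre xs k)
  ... | false = sym (ℤ.+-identityˡ _)

fall-suc : ∀ x n m → fall x (suc n) m ≡ fall x n m * (x - + n * m)
fall-suc x zero    m = shift x m
  where
  shift : ∀ x m → x * + 1 ≡ + 1 * (x - + 0 * m)
  shift = solve-∀
fall-suc x (suc n) m = trans (cong (x *_) (fall-suc (x - m) n m)) (shift x (fall (x - m) n m) m (+ n))
  where
  shift : ∀ x f m n → x * (f * (x - m - n * m)) ≡ x * f * (x - (+ 1 + n) * m)
  shift = solve-∀

+[m∸n]≡+m-+n : ∀ {m n} → n ≤ m → + (m ∸ n) ≡ + m - + n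
+[m∸n]≡+m-+n {m} {n} n≤m = sym (trans (ℤ.m-n≡m⊖n m n) (ℤ.≤-⊖ n≤m))

rooks≤length : ∀ p → rooks p ≤ length p
rooks≤length []            = z≤n
rooks≤length (nothing ∷ p) = ℕ.m≤n⇒m≤1+n (rooks≤length p)
rooks≤length (just _ ∷ p)  = s≤s (rooks≤length p)

rooks-ʳ++ : ∀ p q → rooks (p ʳ++ q) ≡ rooks p ℕ.+ rooks q
rooks-ʳ++ []            q = refl
rooks-ʳ++ (nothing ∷ p) q = rooks-ʳ++ p (nothing ∷ q)
rooks-ʳ++ (just r ∷ p)  q = trans (rooks-ʳ++ p (just r ∷ q)) (ℕ.+-suc (rooks p) (rooks q))

rowCount-ʳ++ : ∀ i p q → rowCount i (p ʳ++ q) ≡ rowCount i p ℕ.+ rowCount i q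
rowCount-ʳ++ i []            q = refl
rowCount-ʳ++ i (nothing ∷ p) q = rowCount-ʳ++ i p (nothing ∷ q)
rowCount-ʳ++ i (just r ∷ p)  q rewrite rowCount-ʳ++ i p (just r ∷ q) with r ≟ i
... | yes _ = ℕ.+-suc (rowCount i p) (rowCount i q)
... | no  _ = refl

rowCount-rook : ∀ r i q → rowCount i (just r ∷ q) ≡ (if does (r ≟ i) then suc (rowCount i q) else rowCount i q)
rowCount-rook r i q = cong (λ b → if b then suc (rowCount i q) else rowCount i q) (isYes≗does (r ≟ i))

+-if-suc : ∀ b y → + (if b then suc y else y) ≡ (if b then + 1 else + 0) + + y
+-if-suc true  y = refl
+-if-suc false y = refl

fall-if-suc : ∀ b y m → fall (+ 1) (if b then suc y else y) m ≡ fall (+ 1) y m * (if b then + 1 - + y * m else + 1)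
fall-if-suc true  y m = fall-suc (+ 1) y m
fall-if-suc false y m = sym (ℤ.*-identityʳ _)

InRows : ℕ → Maybe ℕ → Set
InRows b = Maybe.All (λ r → 1 ≤ r × r ≤ b)

RowsWithin : ℕ → Placement → Set
RowsWithin b = All (InRows b)

RowsWithin-mono : ∀ {b b′ q} → b ≤ b′ → RowsWithin b q → RowsWithin b′ q
RowsWithin-mono b≤b′ = All.map (Maybe.map (λ (1≤r , r≤b) → 1≤r , ℕ.≤-trans r≤b b≤b′))

column : ℕ → List (Maybe ℕ)
column b = nothing ∷ applyUpTo (λ i → just (suc i)) b

column-InRows : ∀ b → All (InRows b) (column b)
column-InRows b = Maybe.nothing ∷ All.applyUpTo⁺₁ _ b (λ i<b → Maybe.just (s≤s z≤n , i<b))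

placements-length : ∀ bs → All (λ p → length p ≡ length bs) (placements bs)
placements-length []       = refl ∷ []
placements-length (b ∷ bs) =
  All.concat⁺ (All.map⁺ (All.map (λ len → All.map⁺ (All.universal (λ _ → cong suc len) (column b)))
                                  (placements-length bs)))

rowCounts-sum : ∀ {b} q → RowsWithin b q → sum (applyUpTo (λ i → + rowCount (suc i) q) b) ≡ + rooks q
rowCounts-sum {b} []                 []                               = Σ.⨁-applyUpTo-ε b
rowCounts-sum     (nothing ∷ q)      (Maybe.nothing ∷ q⊑b)            = rowCounts-sum q q⊑b
rowCounts-sum {b} (just (suc j) ∷ q) (Maybe.just (_ , j<b) ∷ q⊑b) = begin
  sum (applyUpTo (λ i → + rowCount (suc i) (just (suc j) ∷ q)) b)
    ≡⟨ Σ.⨁-applyUpTo-cong b (λ {i} _ → trans (cong +_ (rowCount-rook (suc j) (suc i) q))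
                                              (+-if-suc (does (j ≟ i)) (rowCount (suc i) q))) ⟩
  sum (applyUpTo (λ i → (if does (j ≟ i) then + 1 else + 0) + + rowCount (suc i) q) b)
    ≡⟨ Σ.⨁-applyUpTo-distrib _ _ b ⟩
  sum (applyUpTo (λ i → if does (j ≟ i) then + 1 else + 0) b) + sum (applyUpTo (λ i → + rowCount (suc i) q) b)
    ≡⟨ cong₂ _+_ (Σ.⨁-applyUpTo-δ (λ _ → + 1) j<b) (rowCounts-sum q q⊑b) ⟩
  + 1 + + rooks q ∎
  where open ≡-Reasoning

-- `wt m B` is `weight (maxRow B) m`: the row bound stays that of the whole board throughout the
-- induction over its columns.
module _ (t : ℕ) (m : ℤ) where

  weight : Placement → ℤ
  weight p = product (applyUpTo (λ i → fall (+ 1) (rowCount (suc i) p) m) t)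

  weight-[] : weight [] ≡ + 1
  weight-[] = Π.⨁-applyUpTo-ε t

  weight-reverse : ∀ q → weight (reverse q) ≡ weight q
  weight-reverse q = Π.⨁-applyUpTo-cong t (λ {i} _ →
    cong (λ y → fall (+ 1) y m) (trans (rowCount-ʳ++ (suc i) q []) (ℕ.+-identityʳ _)))

  weight-rook : ∀ {j} q → j < t → weight (just (suc j) ∷ q) ≡ weight q * (+ 1 - + rowCount (suc j) q * m)
  weight-rook {j} q j<t = begin
    weight (just (suc j) ∷ q)
      ≡⟨ Π.⨁-applyUpTo-cong t (λ {i} _ → trans (cong (λ y → fall (+ 1) y m) (rowCount-rook (suc j) (suc i) q))
                                                 (fall-if-suc (does (j ≟ i)) (y i) m)) ⟩
    product (applyUpTo (λ i → fall (+ 1) (y i) m * (if does (j ≟ i) then + 1 - + y i * m else + 1)) t)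
      ≡⟨ Π.⨁-applyUpTo-distrib _ _ t ⟩
    weight q * product (applyUpTo (λ i → if does (j ≟ i) then + 1 - + y i * m else + 1) t)
      ≡⟨ cong (weight q *_) (Π.⨁-applyUpTo-δ (λ i → + 1 - + y i * m) j<t) ⟩
    weight q * (+ 1 - + y j * m) ∎
    where
    open ≡-Reasoning
    y : ℕ → ℕ
    y i = rowCount (suc i) q

  module _ (x : ℤ) where

    contribution : Placement → ℤ
    contribution p = weight p * fall x (length p ∸ rooks p) m

    contribution-reverse : ∀ q → contribution (reverse q) ≡ contribution q
    contribution-reverse q = cong₂ (λ w k → w * fall x k m) (weight-reverse q)
      (cong₂ _∸_ (trans (List.length-ʳ++ q) (ℕ.+-identityʳ _)) (trans (rooks-ʳ++ q []) (ℕ.+-identityʳ _)))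

    sum-contribution-column : ∀ {b} q → RowsWithin b q → b ≤ t →
      sum (map (λ c → contribution (c ∷ q)) (column b)) ≡ (x + + b - + length q * m) * contribution q
    sum-contribution-column {b} q q⊑b b≤t = begin
      contribution (nothing ∷ q) + sum (map (λ c → contribution (c ∷ q)) (applyUpTo (λ i → just (suc i)) b))
        ≡⟨ cong₂ _+_ empty-column (cong sum (List.map-applyUpTo _ _ b)) ⟩
      W * (F * (x - + (n ∸ r) * m)) + sum (applyUpTo (λ i → contribution (just (suc i) ∷ q)) b)
        ≡⟨ cong (λ s → W * (F * (x - + (n ∸ r) * m)) + s) (Σ.⨁-applyUpTo-cong b rook-column) ⟩
      W * (F * (x - + (n ∸ r) * m)) + sum (applyUpTo (λ i → W * F * (+ 1 - + y i * m)) b)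
        ≡⟨ cong (λ s → W * (F * (x - + (n ∸ r) * m)) + s) (sum-applyUpTo-affine (W * F) m (λ i → + y i) b) ⟩
      W * (F * (x - + (n ∸ r) * m)) + W * F * (+ b - sum (applyUpTo (λ i → + y i) b) * m)
        ≡⟨ cong₂ (λ d s → W * (F * (x - d * m)) + W * F * (+ b - s * m)) (+[m∸n]≡+m-+n r≤n) (rowCounts-sum q q⊑b) ⟩
      W * (F * (x - (+ n - + r) * m)) + W * F * (+ b - + r * m)
        ≡⟨ collect W F x (+ n) (+ r) (+ b) m ⟩
      (x + + b - + n * m) * (W * F) ∎
      where
      open ≡-Reasoning
      n r : ℕ
      n = length q
      r = rooks q
      r≤n : r ≤ n
      r≤n = rooks≤length q
      W F : ℤ
      W = weight q
      F = fall x (n ∸ r) m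
      y : ℕ → ℕ
      y i = rowCount (suc i) q
      empty-column : contribution (nothing ∷ q) ≡ W * (F * (x - + (n ∸ r) * m))
      empty-column = cong (W *_) (trans (cong (λ k → fall x k m) (ℕ.+-∸-assoc 1 r≤n)) (fall-suc x (n ∸ r) m))
      rook-column : ∀ {i} → i < b → contribution (just (suc i) ∷ q) ≡ W * F * (+ 1 - + y i * m)
      rook-column {i} i<b = trans (cong (_* F) (weight-rook q (ℕ.<-≤-trans i<b b≤t))) (xy∙z≈xz∙y W _ F)
      collect : ∀ W F x n r b m → W * (F * (x - (n - r) * m)) + W * F * (b - r * m) ≡ (x + b - n * m) * (W * F)
      collect = solve-∀

    -- q holds the already placed columns in reverse, so that placing one more column is a cons.
    sum-contribution-placements : ∀ {lo} q bs →
      RowsWithin lo q → All (lo ≤_) bs → AllPairs _≤_ bs → All (_≤ t) bs →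
      sum (map (λ p → contribution (q ʳ++ p)) (placements bs)) ≡ contribution q * rhsFrom (length q) m x bs
    sum-contribution-placements q []       _    _              _                _            =
      trans (ℤ.+-identityʳ _) (trans (contribution-reverse q) (sym (ℤ.*-identityʳ _)))
    sum-contribution-placements q (b ∷ bs) q⊑lo (lo≤b ∷ lo≤bs) (b≤bs ∷ sorted) (b≤t ∷ bs≤t) = begin
      sum (map (λ p → contribution (q ʳ++ p)) (placements (b ∷ bs)))
        ≡⟨ Σ.⨁-concatMap-map (λ p → contribution (q ʳ++ p)) _∷_ (column b) (placements bs) ⟩
      sum (map (λ p → sum (map (λ c → contribution (q ʳ++ c ∷ p)) (column b))) (placements bs))
        ≡⟨ Σ.⨁-map-comm (λ p c → contribution (q ʳ++ c ∷ p)) (placements bs) (column b) ⟩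
      sum (map (λ c → sum (map (λ p → contribution ((c ∷ q) ʳ++ p)) (placements bs))) (column b))
        ≡⟨ Σ.⨁-map-cong (All.map (λ {c} c⊑b → sum-contribution-placements (c ∷ q) bs (c⊑b ∷ q⊑b) b≤bs sorted bs≤t)
                                 (column-InRows b)) ⟩
      sum (map (λ c → contribution (c ∷ q) * R) (column b))
        ≡⟨ sum-map-*ʳ (λ c → contribution (c ∷ q)) R (column b) ⟩
      sum (map (λ c → contribution (c ∷ q)) (column b)) * R
        ≡⟨ cong (_* R) (sum-contribution-column q q⊑b b≤t) ⟩
      (x + + b - + length q * m) * contribution q * R
        ≡⟨ xy∙z≈y∙xz (x + + b - + length q * m) (contribution q) R ⟩
      contribution q * rhsFrom (length q) m x (b ∷ bs) ∎
      where
      open ≡-Reasoning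
      q⊑b : RowsWithin b q
      q⊑b = RowsWithin-mono lo≤b q⊑lo
      R : ℤ
      R = rhsFrom (suc (length q)) m x bs

lhs≡sum-contribution : ∀ m x B → lhs m x B ≡ sum (map (contribution (maxRow B) m x) (placements B))
lhs≡sum-contribution m x B = begin
  lhs m x B
    ≡⟨ sum-applyUpTo-fibres rooks (wt m B) (λ k → fall x (n ∸ k) m) (placements B)
                            (All.map (λ {p} → rooks<suc-n p) (placements-length B)) ⟩
  sum (map (λ p → wt m B p * fall x (n ∸ rooks p) m) (placements B))
    ≡⟨ Σ.⨁-map-cong (All.map (λ {p} len → cong (λ l → wt m B p * fall x (l ∸ rooks p) m) (sym len))
                             (placements-length B)) ⟩
  sum (map (contribution (maxRow B) m x) (placements B)) ∎
  where
  open ≡-Reasoning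
  n : ℕ
  n = length B
  rooks<suc-n : ∀ p → length p ≡ n → rooks p < suc n
  rooks<suc-n p len = s≤s (ℕ.≤-trans (rooks≤length p) (ℕ.≤-reflexive len))

columns≤maxRow : ∀ B → All (_≤ maxRow B) B
columns≤maxRow []       = []
columns≤maxRow (b ∷ bs) = ℕ.m≤m⊔n b _ ∷ All.map (λ c≤ → ℕ.≤-trans c≤ (ℕ.m≤n⊔m b _)) (columns≤maxRow bs)

theorem6p1 : (m : ℕ) → 1 ≤ m → (B : List ℕ) → Linked _≤_ B → (x : ℤ) →
    lhs (+ m) x B ≡ rhs (+ m) x B
theorem6p1 m _ B ferrers x = begin
  lhs (+ m) x B
    ≡⟨ lhs≡sum-contribution (+ m) x B ⟩
  sum (map (contribution t (+ m) x) (placements B))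
    ≡⟨ sum-contribution-placements t (+ m) x [] B [] (All.universal (λ _ → z≤n) B)
                                   (Linked⇒AllPairs ℕ.≤-trans ferrers) (columns≤maxRow B) ⟩
  contribution t (+ m) x [] * rhs (+ m) x B
    ≡⟨ cong (_* rhs (+ m) x B) (trans (ℤ.*-identityʳ _) (weight-[] t (+ m))) ⟩
  + 1 * rhs (+ m) x B
    ≡⟨ ℤ.*-identityˡ _ ⟩
  rhs (+ m) x B ∎
  where
  open ≡-Reasoning
  t : ℕ
  t = maxRow B
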